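{- If $A \notin DGR$, then $A\wr\!\wr B \notin GR$.
   Context: $GR$ denotes the class of permutation groups that are automorphism groups of colored graphs (complete graphs with edge-coloring functions), and $DGR$ the class of permutation groups that are automorphism groups of colored directed graphs. For permutation groups $(A,V)$ and $(B,W)$, $A\wr\!\wr B$ denotes the wreath product in its product action: the permutation group on $V^W$ consisting of all permutations $\phi$ given by $(f\phi)(w) = (f(w\beta))\alpha_w$ for all $f\in V^W$, $w\in W$, with $\beta\in B$ and $\alpha_w\in A$ for each $w\in W$ (permutations act on the right). -}

module Defs where

open import Data.Nat using (ℕ)
open import Data.Fin using (Fin)
open import Data.Vec using (Vec; lookup)
open import Data.Product using (Σ; _×_; ∃)
open import Relation.Binary.PropositionalEquality using (_≡_; _≢_)
open import Function.Bundles using (_↔_; Inverse)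
open import Function.Construct.Composition using (_↔-∘_)
open import Function.Construct.Identity using (↔-id)
open import Function.Construct.Symmetry using (↔-sym)

Perm : Set → Set
Perm X = X ↔ X

_·_ : {X : Set} → X → Perm X → X
x · σ = Inverse.to σ x

record PermGroup (X : Set) : Set₁ where
  field
    mem      : Perm X → Set
    mem-resp : ∀ {σ τ} → (∀ x → x · σ ≡ x · τ) → mem σ → mem τ
    mem-id   : mem (↔-id X)
    mem-∘    : ∀ {σ τ} → mem σ → mem τ → mem (σ ↔-∘ τ)
    mem-inv  : ∀ {σ} → mem σ → mem (↔-sym σ)
open PermGroup public

-- A colored (directed) graph on X: a complete (di)graph whose edges, i.e.
-- (ordered) pairs of distinct vertices, are colored; colors are natural numbers.
Coloring : Set → Set
Coloring X = X → X → ℕ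

Symmetric : {X : Set} → Coloring X → Set
Symmetric {X} c = ∀ (x y : X) → c x y ≡ c y x

IsAut : {X : Set} → Coloring X → Perm X → Set
IsAut {X} c σ = ∀ (x y : X) → x ≢ y → c (x · σ) (y · σ) ≡ c x y

IsAutGroupOf : {X : Set} → PermGroup X → Coloring X → Set
IsAutGroupOf G c = ∀ σ → (mem G σ → IsAut c σ) × (IsAut c σ → mem G σ)

InGR : {X : Set} → PermGroup X → Set
InGR {X} G = Σ (Coloring X) λ c → Symmetric c × IsAutGroupOf G c

InDGR : {X : Set} → PermGroup X → Set
InDGR {X} G = Σ (Coloring X) λ c → IsAutGroupOf G c

-- Membership in the wreath product A ≀≀ B in product action on V^W, with
-- V = Fin n, W = Fin m, and V^W represented as Vec (Fin n) m:
-- φ ∈ A ≀≀ B iff there are β ∈ B and α_w ∈ A (w ∈ W) such that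
-- (f φ)(w) = (f (w β)) α_w for all f, w.
WrMem : {n m : ℕ} → PermGroup (Fin n) → PermGroup (Fin m) → Perm (Vec (Fin n) m) → Set
WrMem {n} {m} A B φ =
  Σ (Perm (Fin m)) λ β → mem B β ×
  Σ (Fin m → Perm (Fin n)) λ α → (∀ w → mem A (α w)) ×
    (∀ (f : Vec (Fin n) m) (w : Fin m) → lookup (f · φ) w ≡ lookup f (w · β) · α w)

-- A colored digraph c on V^W whose automorphism group is A ≀≀ B induces a
-- colored digraph on V: the arc (x , y) is colored by the class of the
-- picture of c on the vertices whose first coordinate is x or y (with the
-- roles of x and y remembered), two pictures being equal if they agree off
-- the diagonal. A permutation σ of V preserves these colors iff the
-- permutation acting as σ on the first coordinate alone preserves c, i.e.
-- iff it lies in A ≀≀ B, i.e. iff σ ∈ A. So A ∈ DGR.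
module Submission where

open import Defs
open import Data.Bool using (Bool; true; false; if_then_else_)
import Data.Bool.Properties as Bool
open import Data.Fin using (Fin; zero; suc; _≟_)
import Data.Fin.Properties as Fin
open import Data.List using (List; []; _∷_; allFin; cartesianProduct)
open import Data.List.Membership.Propositional using (_∈_)
open import Data.List.Membership.Propositional.Properties using (∈-allFin; ∈-cartesianProduct⁺)
open import Data.List.Relation.Unary.Any using (here; there)
open import Data.Nat using (ℕ; suc)
open import Data.Nat.Properties using (0≢1+n; suc-injective)
import Data.Nat.Properties as ℕ
open import Data.Product using (_×_; _,_; proj₁; proj₂)
open import Data.Product.Properties using (,-injectiveʳ)
import Data.Product.Properties as Product
open import Data.Vec using (Vec; []; _∷_; lookup; replicate)
open import Data.Vec.Properties using (∷-injectiveˡ; ∷-injectiveʳ; lookup-replicate)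
import Data.Vec.Properties as Vec
open import Function using (_∘_; _on_)
open import Function.Bundles using (_⇔_; Equivalence; Inverse; mk⇔; mk↔ₛ′)
open import Function.Construct.Identity using (↔-id)
open import Level using (0ℓ)
open import Relation.Binary.Core using (Rel)
open import Relation.Binary.Definitions using (DecidableEquality)
open import Relation.Binary.PropositionalEquality
open import Relation.Binary.Structures using (IsEquivalence; IsDecEquivalence)
open import Relation.Nullary using (¬_; Dec; yes; no; contradiction; ¬?)
open import Relation.Nullary.Decidable using (map′; _×-dec_; _→-dec_)

InGR⇒InDGR : {X : Set} {G : PermGroup X} → InGR G → InDGR G
InGR⇒InDGR (c , _ , c-aut) = c , c-aut

Searchable : Set → Set₁
Searchable X = {P : X → Set} → (∀ x → Dec (P x)) → Dec (∀ x → P x)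

Bool-searchable : Searchable Bool
Bool-searchable P? = map′ (λ { (p , q) true → p ; (p , q) false → q }) (λ h → h true , h false)
  (P? true ×-dec P? false)

×-searchable : {X Y : Set} → Searchable X → Searchable Y → Searchable (X × Y)
×-searchable ∀X? ∀Y? P? = map′ (λ h (x , y) → h x y) (λ h x y → h (x , y))
  (∀X? λ x → ∀Y? λ y → P? (x , y))

Vec-searchable : {X : Set} → Searchable X → ∀ k → Searchable (Vec X k)
Vec-searchable ∀? 0 P? = map′ (λ { p [] → p }) (λ h → h []) (P? [])
Vec-searchable ∀? (suc k) P? = map′ (λ { h (x ∷ v) → h x v }) (λ h x v → h (x ∷ v))
  (∀? λ x → Vec-searchable ∀? k (λ v → P? (x ∷ v)))

AgreeOffDiagonal : {X : Set} → Coloring X → Coloring X → Set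
AgreeOffDiagonal {X} c c′ = ∀ (x y : X) → x ≢ y → c x y ≡ c′ x y

module _ {X : Set} where

  agreeOffDiagonal-isEquivalence : IsEquivalence (AgreeOffDiagonal {X})
  agreeOffDiagonal-isEquivalence = record
    { refl  = λ x y _ → refl
    ; sym   = λ c≐c′ x y x≢y → sym (c≐c′ x y x≢y)
    ; trans = λ c≐c′ c′≐c″ x y x≢y → trans (c≐c′ x y x≢y) (c′≐c″ x y x≢y)
    }

  agreeOffDiagonal? : DecidableEquality X → Searchable X → ∀ c c′ → Dec (AgreeOffDiagonal c c′)
  agreeOffDiagonal? _≟X_ ∀? c c′ = ∀? λ x → ∀? λ y → ¬? (x ≟X y) →-dec (c x y ℕ.≟ c′ x y)

-- Colors are natural numbers, so an equivalence class is encoded by the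
-- position of its first member in an enumeration.
module Classification {X : Set} {_≈_ : Rel X 0ℓ} (≈-isDecEquivalence : IsDecEquivalence _≈_)
                      (xs : List X) (complete : ∀ x → x ∈ xs) where
  open IsDecEquivalence ≈-isDecEquivalence using ()
    renaming (_≟_ to _≈?_; refl to ≈-refl; sym to ≈-sym; trans to ≈-trans)

  firstMatch : List X → X → ℕ
  firstMatch []       x = 0
  firstMatch (y ∷ ys) x with x ≈? y
  ... | yes _ = 0
  ... | no  _ = suc (firstMatch ys x)

  firstMatch-resp-≈ : ∀ ys {x x′} → x ≈ x′ → firstMatch ys x ≡ firstMatch ys x′
  firstMatch-resp-≈ []       x≈x′ = refl
  firstMatch-resp-≈ (y ∷ ys) {x} {x′} x≈x′ with x ≈? y | x′ ≈? y
  ... | yes _   | yes _    = refl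
  ... | yes x≈y | no x′≉y  = contradiction (≈-trans (≈-sym x≈x′) x≈y) x′≉y
  ... | no x≉y  | yes x′≈y = contradiction (≈-trans x≈x′ x′≈y) x≉y
  ... | no _    | no _     = cong suc (firstMatch-resp-≈ ys x≈x′)

  firstMatch-injective : ∀ ys {x x′} → x ∈ ys → firstMatch ys x ≡ firstMatch ys x′ → x ≈ x′
  firstMatch-injective (y ∷ ys) {x} {x′} x∈ys eq with x ≈? y | x′ ≈? y
  ... | yes x≈y | yes x′≈y = ≈-trans x≈y (≈-sym x′≈y)
  ... | yes _   | no _     = contradiction eq 0≢1+n
  ... | no _    | yes _    = contradiction (sym eq) 0≢1+n
  ... | no x≉y  | no _     with x∈ys
  ...   | here refl   = contradiction ≈-refl x≉y
  ...   | there x∈ys′ = firstMatch-injective ys x∈ys′ (suc-injective eq)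

  class : X → ℕ
  class = firstMatch xs

  class-≡⇔≈ : ∀ {x x′} → class x ≡ class x′ ⇔ x ≈ x′
  class-≡⇔≈ {x} = mk⇔ (firstMatch-injective xs (complete x)) (firstMatch-resp-≈ xs)

onHead : {X : Set} {m : ℕ} → Perm X → Perm (Vec X (suc m))
onHead σ = mk↔ₛ′ (λ { (x ∷ r) → x · σ ∷ r }) (λ { (x ∷ r) → Inverse.from σ x ∷ r })
  (λ { (x ∷ r) → cong (_∷ r) (Inverse.strictlyInverseˡ σ x) })
  (λ { (x ∷ r) → cong (_∷ r) (Inverse.strictlyInverseʳ σ x) })

-- A vertex of V^(1+m) whose first coordinate is left as a slot for the
-- first (true) or second (false) point of a pair.
Template : ℕ → ℕ → Set
Template n m = Bool × Vec (Fin n) m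

fill : {n m : ℕ} → Fin n × Fin n → Template n m → Vec (Fin n) (suc m)
fill (x , y) (a , r) = (if a then x else y) ∷ r

fill-injective : {n m : ℕ} {x y : Fin n} → x ≢ y → {t u : Template n m} →
  fill (x , y) t ≡ fill (x , y) u → t ≡ u
fill-injective x≢y {true  , r} {true  , s} eq = cong (true ,_) (∷-injectiveʳ eq)
fill-injective x≢y {false , r} {false , s} eq = cong (false ,_) (∷-injectiveʳ eq)
fill-injective x≢y {true  , r} {false , s} eq = contradiction (∷-injectiveˡ eq) x≢y
fill-injective x≢y {false , r} {true  , s} eq = contradiction (sym (∷-injectiveˡ eq)) x≢y

fill-onHead : {n m : ℕ} (σ : Perm (Fin n)) (x y : Fin n) (t : Template n m) →
  fill (x , y) t · onHead σ ≡ fill (x · σ , y · σ) t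
fill-onHead σ x y (true  , r) = refl
fill-onHead σ x y (false , r) = refl

module InducedColoring {n m : ℕ} (c : Coloring (Vec (Fin n) (suc m))) where

  _∼_ : Rel (Fin n × Fin n) 0ℓ
  p ∼ q = AgreeOffDiagonal (c on fill p) (c on fill q)

  ∼-isDecEquivalence : IsDecEquivalence _∼_
  ∼-isDecEquivalence = record
    { isEquivalence = record { refl = ≐.refl ; sym = ≐.sym ; trans = ≐.trans }
    ; _≟_ = λ p q → agreeOffDiagonal? template-≟ template-searchable (c on fill p) (c on fill q)
    }
    where
    module ≐ = IsEquivalence agreeOffDiagonal-isEquivalence
    template-≟ : DecidableEquality (Template n m)
    template-≟ = Product.≡-dec Bool._≟_ (Vec.≡-dec _≟_)
    template-searchable : Searchable (Template n m)
    template-searchable = ×-searchable Bool-searchable (Vec-searchable Fin.all? m)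

  open Classification ∼-isDecEquivalence (cartesianProduct (allFin n) (allFin n))
    (λ (x , y) → ∈-cartesianProduct⁺ (∈-allFin x) (∈-allFin y))

  induced : Coloring (Fin n)
  induced x y = class (x , y)

  onHead-aut⇒∼ : ∀ {σ} → IsAut c (onHead σ) → ∀ {x y} → x ≢ y → (x · σ , y · σ) ∼ (x , y)
  onHead-aut⇒∼ {σ} aut {x} {y} x≢y t u t≢u = begin
    c (fill (x · σ , y · σ) t) (fill (x · σ , y · σ) u)
      ≡⟨ sym (cong₂ c (fill-onHead σ x y t) (fill-onHead σ x y u)) ⟩
    c (fill (x , y) t · onHead σ) (fill (x , y) u · onHead σ)
      ≡⟨ aut (fill (x , y) t) (fill (x , y) u) (t≢u ∘ fill-injective x≢y) ⟩
    c (fill (x , y) t) (fill (x , y) u) ∎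
    where open ≡-Reasoning

  -- For two vertices with the same first coordinate x, compare the pairs
  -- (x , x · σ) and its image, unless σ fixes x.
  ∼⇒onHead-aut : ∀ {σ} → (∀ {x y} → x ≢ y → (x · σ , y · σ) ∼ (x , y)) → IsAut c (onHead σ)
  ∼⇒onHead-aut {σ} ∼-image (x ∷ r) (y ∷ s) x∷r≢y∷s with x ≟ y
  ... | no x≢y = ∼-image x≢y (true , r) (false , s) (λ ())
  ... | yes refl with x · σ ≟ x
  ...   | yes xσ≡x = cong₂ (λ u v → c (u ∷ r) (v ∷ s)) xσ≡x xσ≡x
  ...   | no xσ≢x  = ∼-image (xσ≢x ∘ sym) (true , r) (true , s) (x∷r≢y∷s ∘ cong (x ∷_) ∘ ,-injectiveʳ)

  IsAut-induced⇔ : ∀ {σ} → IsAut induced σ ⇔ IsAut c (onHead σ)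
  IsAut-induced⇔ = mk⇔
    (λ aut → ∼⇒onHead-aut λ {x} {y} x≢y → Equivalence.to class-≡⇔≈ (aut x y x≢y))
    (λ aut x y x≢y → Equivalence.from class-≡⇔≈ (onHead-aut⇒∼ aut x≢y))

module _ {n m : ℕ} (A : PermGroup (Fin n)) (B : PermGroup (Fin (suc m))) where

  onHead-∈-wreath : ∀ {σ} → mem A σ → WrMem A B (onHead σ)
  onHead-∈-wreath {σ} σ∈A = ↔-id _ , mem-id B , α , α∈A ,
    λ { (x ∷ r) zero → refl ; (x ∷ r) (suc w) → refl }
    where
    α : Fin (suc m) → Perm (Fin n)
    α zero    = σ
    α (suc _) = ↔-id _
    α∈A : ∀ w → mem A (α w)
    α∈A zero    = σ∈A
    α∈A (suc _) = mem-id A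

  -- Evaluate at a constant vector: its first coordinate is moved by α zero.
  wreath-onHead⇒∈ : ∀ {σ} → WrMem A B (onHead σ) → mem A σ
  wreath-onHead⇒∈ {σ} (β , _ , α , α∈A , act) = mem-resp A α₀≗σ (α∈A zero)
    where
    α₀≗σ : ∀ x → x · α zero ≡ x · σ
    α₀≗σ x = begin
      x · α zero                                       ≡⟨ cong (_· α zero) (lookup-replicate (zero · β) x) ⟨
      lookup (replicate (suc m) x) (zero · β) · α zero ≡⟨ act (replicate (suc m) x) zero ⟨
      x · σ                                            ∎
      where open ≡-Reasoning

wreath∈DGR⇒∈DGR : {n m : ℕ} (A : PermGroup (Fin n)) (B : PermGroup (Fin (suc m)))
  (AwrB : PermGroup (Vec (Fin n) (suc m))) →
  (∀ φ → mem AwrB φ → WrMem A B φ) → (∀ φ → WrMem A B φ → mem AwrB φ) →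
  InDGR AwrB → InDGR A
wreath∈DGR⇒∈DGR A B AwrB wreath-sound wreath-complete (c , c-aut) = induced , λ σ →
  (λ σ∈A → Equivalence.from IsAut-induced⇔
     (proj₁ (c-aut (onHead σ)) (wreath-complete (onHead σ) (onHead-∈-wreath A B σ∈A)))) ,
  (λ aut → wreath-onHead⇒∈ A B
     (wreath-sound (onHead σ) (proj₂ (c-aut (onHead σ)) (Equivalence.to IsAut-induced⇔ aut))))
  where open InducedColoring c

lemma3p4 : (n m : ℕ) (A : PermGroup (Fin n)) (B : PermGroup (Fin (suc m)))
    (AwrB : PermGroup (Vec (Fin n) (suc m))) → (∀ φ → mem AwrB φ → WrMem A B φ) → (∀ φ → WrMem A B φ → mem AwrB φ)
    → ¬ InDGR A → ¬ InGR AwrB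
lemma3p4 n m A B AwrB wreath-sound wreath-complete A∉DGR AwrB∈GR =
  A∉DGR (wreath∈DGR⇒∈DGR A B AwrB wreath-sound wreath-complete (InGR⇒InDGR {G = AwrB} AwrB∈GR))
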